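{- For all integers $n\ge0$ and $m$, the mapping $\gamma$ (applied at the columns $c=3i+1$, $0\le i\le n$) is a bijection from the set of Schröder paths (respectively Delannoy paths) from $(0,0)$ to $(3n+2,m)$ that are smooth at each horizontal distance $3i+1$ from the origin for $0\le i\le n$, to the set of vertically constrained $S_{CW}$ paths from $(0,0)$ to $(n,m)$ all of whose vertices have $y\ge0$ (respectively, with no height restriction), first step arbitrary.
   Context: A lattice path is a finite sequence of steps (vectors in $\mathbb{Z}^2$) starting at $(0,0)$; its vertices are the partial sums. Let $S_C=\{(1,1),(1,-1),(2,0)\}$. A Delannoy path is a lattice path with steps in $S_C$; a Schröder path is a Delannoy path all of whose vertices have $y\ge0$. A path is smooth at the integer column $x=c$ if either it contains a step $(2,0)$ from $(c-1,y)$ to $(c+1,y)$ for some $y$, or it has a vertex with $x$-coordinate $c$ and the step ending at that vertex equals the step starting at it (two consecutive equal steps $(1,1)(1,1)$, $(1,-1)(1,-1)$ or $(2,0)(2,0)$ meeting at $x=c$). The map $\gamma$ performs, at each designated column $c$, the substitution: $(1,1)(1,1)$ meeting at $c$ $\mapsto(0,2)$; $(1,-1)(1,-1)$ meeting at $c$ $\mapsto(0,-2)$; $(2,0)(2,0)$ meeting at $c$ $\mapsto(2,0)$; a single $(2,0)$ step with midpoint at $x=c$ is removed; all other steps are kept and the resulting steps concatenated in order. Let $S_{CW}=S_C\cup\{(0,2),(0,-2)\}$, with $(0,\pm2)$ vertical; a vertically constrained $S_{CW}$ path is a lattice path with steps in $S_{CW}$ with no two consecutive vertical steps. -}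

module Defs where

open import Data.Nat using (ℕ; zero; suc; _+_; _*_; _≡ᵇ_)
open import Data.Integer using (ℤ; +_; -[1+_]; _≤_) renaming (_+_ to _+ℤ_)
open import Data.Bool using (Bool; true; false; _∧_; if_then_else_)
open import Data.List using (List; []; _∷_; upTo)
open import Data.Bool.ListAction using (any)
open import Data.List.Relation.Unary.All using (All)
open import Data.Product using (_×_; _,_; proj₂; ∃)
open import Data.Unit using (⊤)
open import Relation.Binary.PropositionalEquality using (_≡_)

-- Steps of S_CW = S_C ∪ {(0,2),(0,-2)}.
-- U = (1,1), D = (1,-1), H = (2,0), VU = (0,2), VD = (0,-2).
data Step : Set where
  U D H VU VD : Step

dx : Step → ℕ
dx U  = 1
dx D  = 1
dx H  = 2
dx VU = 0
dx VD = 0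

dy : Step → ℤ
dy U  = + 1
dy D  = -[1+ 0 ]
dy H  = + 0
dy VU = + 2
dy VD = -[1+ 1 ]

data InSC : Step → Set where
  inU : InSC U
  inD : InSC D
  inH : InSC H

isVert : Step → Bool
isVert VU = true
isVert VD = true
isVert _  = false

_==_ : Step → Step → Bool
U  == U  = true
D  == D  = true
H  == H  = true
VU == VU = true
VD == VD = true
_  == _  = false

isH : Step → Bool
isH H = true
isH _ = false

Point : Set
Point = ℕ × ℤ

_⊕_ : Point → Step → Point
(x , y) ⊕ s = (x + dx s , y +ℤ dy s)

vertsFrom : Point → List Step → List Point
vertsFrom p []       = p ∷ []
vertsFrom p (s ∷ ss) = p ∷ vertsFrom (p ⊕ s) ss

vertices : List Step → List Point
vertices = vertsFrom (0 , + 0)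

endFrom : Point → List Step → Point
endFrom p []       = p
endFrom p (s ∷ ss) = endFrom (p ⊕ s) ss

endpoint : List Step → Point
endpoint = endFrom (0 , + 0)

Nonneg : List Step → Set
Nonneg p = All (λ v → + 0 ≤ proj₂ v) (vertices p)

DelannoyTo : Point → List Step → Set
DelannoyTo q p = All InSC p × endpoint p ≡ q

SchroderTo : Point → List Step → Set
SchroderTo q p = DelannoyTo q p × Nonneg p

NoVV : List Step → Set
NoVV []           = ⊤
NoVV (s ∷ [])     = ⊤
NoVV (s ∷ t ∷ ss) = (isVert s ∧ isVert t) ≡ false × NoVV (t ∷ ss)

VCTo : Point → List Step → Set
VCTo q p = NoVV p × endpoint p ≡ q

-- smoothness at column c; the ℕ index is the x-coordinate of the
-- current vertex (y plays no role).
data SmoothFrom (c : ℕ) : ℕ → List Step → Set where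
  -- a step (2,0) from (c-1,y) to (c+1,y)
  midH  : ∀ {x ss} → suc x ≡ c → SmoothFrom c x (H ∷ ss)
  -- two consecutive equal steps meeting at a vertex with x = c
  pair  : ∀ {x s ss} → x + dx s ≡ c → SmoothFrom c x (s ∷ s ∷ ss)
  there : ∀ {x s ss} → SmoothFrom c (x + dx s) ss → SmoothFrom c x (s ∷ ss)

SmoothAt : ℕ → List Step → Set
SmoothAt c p = SmoothFrom c 0 p

designated : ℕ → ℕ → Bool
designated n c = any (λ i → c ≡ᵇ 3 * i + 1) (upTo (suc n))

SmoothAll : ℕ → List Step → Set
SmoothAll n p = ∀ i → i Data.Nat.≤ n → SmoothAt (3 * i + 1) p

-- replacement of a pair of equal steps meeting at a designated column
repl : Step → Step
repl U = VU
repl D = VD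
repl s = s       -- (2,0)(2,0) ↦ (2,0)

mutual
  γFrom : (ℕ → Bool) → ℕ → List Step → List Step
  γFrom d x []       = []
  γFrom d x (s ∷ ss) =
    if isH s ∧ d (suc x)
      then γFrom d (x + 2) ss          -- single (2,0) with midpoint at designated column: removed
      else γPair d x s ss

  γPair : (ℕ → Bool) → ℕ → Step → List Step → List Step
  γPair d x s []       = s ∷ []
  γPair d x s (t ∷ ss) =
    if d (x + dx s) ∧ (s == t)
      then repl s ∷ γFrom d (x + dx s + dx t) ss
      else s ∷ γFrom d (x + dx s) (t ∷ ss)

γ : ℕ → List Step → List Step
γ n = γFrom (designated n) 0

record BijectionOn (f : List Step → List Step)
                   (P Q : List Step → Set) : Set where
  field
    maps      : ∀ p → P p → Q (f p)
    injective : ∀ p q → P p → P q → f p ≡ f q → p ≡ q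
    surjective : ∀ r → Q r → ∃ λ p → P p × f p ≡ r

module Submission where

-- A Delannoy path smooth at every designated column 3i+1 is cut by these
-- columns into uniquely determined blocks.  At column 3j+1 the path either
-- crosses with a single (2,0) step, or has a pair UU or DD meeting there;
-- from 3j+2 it then either takes one step U or D to 3j+3, or takes HH meeting
-- at the next designated column.  γ acts on each block separately
-- (H ↦ nothing, UU ↦ VU, DD ↦ VD, U ↦ U, D ↦ D, HH ↦ H), so the pairs (p , γ p)
-- are exactly the derivations of a two-state grammar.  Reading the grammar
-- backwards rebuilds p from any vertically constrained path r, the vertical
-- steps of r being precisely the blocks UU and DD, which are never adjacent.
-- Every block preserves the height gained and the lowest height reached, and
-- the horizontal extent shrinks from 3k+2 to k.

open import Defs
open import Data.Nat using (ℕ; suc; _+_; _*_; _≤_; _<_; z≤n; s≤s; s≤s⁻¹; z<s; _≤?_)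
open import Data.Nat.Properties
open import Data.Nat.Tactic.RingSolver using (solve-∀)
open import Data.Integer using (ℤ; +_; -[1+_]) renaming (_+_ to _+ℤ_; _≤_ to _≤ℤ_)
import Data.Integer.Properties as ℤ
open import Data.Bool using (Bool; true; false; _∧_)
open import Data.Bool.Properties using (∧-zeroʳ; T-≡)
open import Data.List using (List; []; _∷_; upTo)
open import Data.List.Relation.Unary.All using (All; []; _∷_)
open import Data.List.Relation.Unary.Any using (satisfied)
open import Data.List.Relation.Unary.Any.Properties using (any⁺; any⁻)
open import Data.List.Membership.Propositional using (lose)
open import Data.List.Membership.Propositional.Properties using (∈-upTo⁺)
open import Data.Product using (_×_; _,_; proj₁; proj₂; ∃; map; map₂)
open import Data.Product.Properties using (,-injective)
open import Data.Sum using (inj₁; inj₂)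
open import Data.Unit using (⊤; tt)
open import Data.Empty using (⊥-elim)
open import Function using (_∘_; _⇔_; mk⇔; Equivalence)
open Equivalence using (to; from)
open import Relation.Nullary using (yes; no; contradiction)
open import Relation.Binary.PropositionalEquality

3i+2+1≡3[1+i] : ∀ i → 3 * i + 2 + 1 ≡ 3 * suc i
3i+2+1≡3[1+i] = solve-∀

3i+2+2≡3[1+i]+1 : ∀ i → 3 * i + 2 + 2 ≡ 3 * suc i + 1
3i+2+2≡3[1+i]+1 = solve-∀

3i+2+2+2≡3[2+i] : ∀ i → 3 * i + 2 + 2 + 2 ≡ 3 * suc (suc i)
3i+2+2+2≡3[2+i] = solve-∀

1+[3i+2]≡3[1+i] : ∀ i → suc (3 * i + 2) ≡ 3 * suc i
1+[3i+2]≡3[1+i] i = trans (+-comm 1 (3 * i + 2)) (3i+2+1≡3[1+i] i)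

4+[3i+2]≡3[2+i] : ∀ i → 4 + (3 * i + 2) ≡ 3 * suc (suc i)
4+[3i+2]≡3[2+i] = solve-∀

3*≢3*+1 : ∀ j i → 3 * j ≢ 3 * i + 1
3*≢3*+1 j i eq with j ≤? i
... | yes j≤i = <⇒≱ (m<m+n (3 * i) z<s) (subst (_≤ 3 * i) eq (*-monoʳ-≤ 3 j≤i))
... | no  j≰i = <⇒≱ (subst (3 * i + 1 <_) (1+[3i+2]≡3[1+i] i) (s≤s (+-monoʳ-≤ (3 * i) (s≤s z≤n))))
                    (subst (3 * suc i ≤_) eq (*-monoʳ-≤ 3 (≰⇒> j≰i)))

3*-≤-cancel : ∀ {a b} → 3 * a ≤ 3 * b + 2 → a ≤ b
3*-≤-cancel {a} {b} h = s≤s⁻¹ (*-cancelˡ-< 3 a (suc b)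
  (≤-<-trans h (subst (3 * b + 2 <_) (3i+2+1≡3[1+i] b) (m<m+n (3 * b + 2) z<s))))

3*+2-injective : ∀ {a b} → 3 * a + 2 ≡ 3 * b + 2 → a ≡ b
3*+2-injective {a} {b} e = *-cancelˡ-≡ a b 3 (+-cancelʳ-≡ 2 (3 * a) (3 * b) e)

designated-3i+1≡true : ∀ {n i c} → i ≤ n → c ≡ 3 * i + 1 → designated n c ≡ true
designated-3i+1≡true {i = i} i≤n refl = to T-≡
  (any⁺ _ (lose (∈-upTo⁺ (s≤s i≤n)) (≡⇒≡ᵇ (3 * i + 1) (3 * i + 1) refl)))

designated-3j≡false : ∀ n j {c} → c ≡ 3 * j → designated n c ≡ false
designated-3j≡false n j {c} refl with designated n c in eq
... | false = refl
... | true with satisfied (any⁻ _ (upTo (suc n)) (from T-≡ eq))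
...   | i , 3j≡ᵇ3i+1 = ⊥-elim (3*≢3*+1 j i (≡ᵇ⇒≡ (3 * j) (3 * i + 1) 3j≡ᵇ3i+1))

==-refl : ∀ s → (s == s) ≡ true
==-refl U  = refl
==-refl D  = refl
==-refl H  = refl
==-refl VU = refl
==-refl VD = refl

γFrom-drop : ∀ d x p → d (suc x) ≡ true → γFrom d x (H ∷ p) ≡ γFrom d (x + 2) p
γFrom-drop _ _ _ e rewrite e = refl

γFrom-keep : ∀ d x p → d (suc x) ≡ false → γFrom d x (H ∷ p) ≡ γPair d x H p
γFrom-keep _ _ _ e rewrite e = refl

γPair-merge : ∀ d x s p → d (x + dx s) ≡ true →
              γPair d x s (s ∷ p) ≡ repl s ∷ γFrom d (x + dx s + dx s) p
γPair-merge _ _ s _ e rewrite e | ==-refl s = refl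

γPair-keep : ∀ d x s p → d (x + dx s) ≡ false →
             γPair d x s p ≡ s ∷ γFrom d (x + dx s) p
γPair-keep _ _ _ []      _ = refl
γPair-keep _ _ _ (_ ∷ _) e rewrite e = refl

dx-pos : ∀ {s} → InSC s → 0 < dx s
dx-pos inU = z<s
dx-pos inD = z<s
dx-pos inH = z<s

SmoothFrom-< : ∀ {c x ss} → All InSC ss → SmoothFrom c x ss → x < c
SmoothFrom-< _                (midH refl)       = ≤-refl
SmoothFrom-< {x = x} (s∈ ∷ _)  (pair refl)       = m<m+n x (dx-pos s∈)
SmoothFrom-< {x = x} (_ ∷ ins) (there {s = s} S) = ≤-<-trans (m≤m+n x (dx s)) (SmoothFrom-< ins S)

SmoothFrom-tail : ∀ {c x s ss} → SmoothFrom c x (s ∷ ss) → x + dx s < c →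
                  SmoothFrom c (x + dx s) ss
SmoothFrom-tail {x = x} (midH refl) lt = contradiction (s≤s⁻¹ lt) (m+1+n≰m x)
SmoothFrom-tail (pair refl) lt = contradiction lt (<-irrefl refl)
SmoothFrom-tail (there S)   _  = S

SmoothAfter : ℕ → ℕ → List Step → Set
SmoothAfter n x p = ∀ i → i ≤ n → x < 3 * i + 1 → SmoothFrom (3 * i + 1) x p

SmoothAfter-tail : ∀ {n x s ss} → SmoothAfter n x (s ∷ ss) → SmoothAfter n (x + dx s) ss
SmoothAfter-tail {x = x} {s} sm i i≤n lt =
  SmoothFrom-tail (sm i i≤n (≤-<-trans (m≤m+n x (dx s)) lt)) lt

NonVerticalHead : List Step → Set
NonVerticalHead []      = ⊤
NonVerticalHead (s ∷ _) = isVert s ≡ false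

NoVV-tail : ∀ {s r} → NoVV (s ∷ r) → NoVV r
NoVV-tail {r = []}    _        = tt
NoVV-tail {r = _ ∷ _} (_ , nv) = nv

NoVV-∷-nonvertical : ∀ {s r} → isVert s ≡ false → NoVV r → NoVV (s ∷ r)
NoVV-∷-nonvertical {r = []}    _ _  = tt
NoVV-∷-nonvertical {r = _ ∷ _} e nv = cong (_∧ _) e , nv

NoVV-∷ : ∀ {s r} → NonVerticalHead r → NoVV r → NoVV (s ∷ r)
NoVV-∷ {r = []}    _ _  = tt
NoVV-∷ {s} {_ ∷ _} e nv = trans (cong (isVert s ∧_) e) (∧-zeroʳ (isVert s)) , nv

NoVV-vertical⇒NonVerticalHead : ∀ {s r} → isVert s ≡ true → NoVV (s ∷ r) → NonVerticalHead r
NoVV-vertical⇒NonVerticalHead {r = []}    _ _       = tt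
NoVV-vertical⇒NonVerticalHead {r = _ ∷ _} v (e , _) = trans (sym (cong (_∧ _) v)) e

Δx : List Step → ℕ
Δx []       = 0
Δx (s ∷ ss) = dx s + Δx ss

Δy : List Step → ℤ
Δy []       = + 0
Δy (s ∷ ss) = dy s +ℤ Δy ss

endFrom≡ : ∀ x y ss → endFrom (x , y) ss ≡ (x + Δx ss , y +ℤ Δy ss)
endFrom≡ x y []       = sym (cong₂ _,_ (+-identityʳ x) (ℤ.+-identityʳ y))
endFrom≡ x y (s ∷ ss) =
  trans (endFrom≡ (x + dx s) (y +ℤ dy s) ss)
        (cong₂ _,_ (+-assoc x (dx s) (Δx ss)) (ℤ.+-assoc y (dy s) (Δy ss)))

endpoint≡⇔ : ∀ ss {a b} → endpoint ss ≡ (a , b) ⇔ (Δx ss ≡ a × Δy ss ≡ b)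
endpoint≡⇔ ss = mk⇔ (λ e → ,-injective (trans (sym endpoint≡Δ) e))
                      (λ (ea , eb) → trans endpoint≡Δ (cong₂ _,_ ea eb))
  where
  endpoint≡Δ : endpoint ss ≡ (Δx ss , Δy ss)
  endpoint≡Δ = trans (endFrom≡ 0 (+ 0) ss) (cong (Δx ss ,_) (ℤ.+-identityˡ (Δy ss)))

EndsAt : ℕ → ℕ → List Step → Set
EndsAt N x []       = x ≡ N
EndsAt N x (s ∷ ss) = EndsAt N (x + dx s) ss

EndsAt⇒≤ : ∀ {N} x p → EndsAt N x p → x ≤ N
EndsAt⇒≤ x []       refl = ≤-refl
EndsAt⇒≤ x (s ∷ ss) e    = ≤-trans (m≤m+n x (dx s)) (EndsAt⇒≤ (x + dx s) ss e)

endFrom⇒EndsAt : ∀ {N} x y p → proj₁ (endFrom (x , y) p) ≡ N → EndsAt N x p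
endFrom⇒EndsAt x y []       e = e
endFrom⇒EndsAt x y (s ∷ ss) e = endFrom⇒EndsAt (x + dx s) (y +ℤ dy s) ss e

Above : ℤ → Point → Set
Above k v = k ≤ℤ proj₂ v

AboveFrom : ℤ → Point → List Step → Set
AboveFrom k v ss = All (Above k) (vertsFrom v ss)

AboveFrom-head : ∀ {k x y} ss → AboveFrom k (x , y) ss → k ≤ℤ y
AboveFrom-head []      (h ∷ _) = h
AboveFrom-head (_ ∷ _) (h ∷ _) = h

bijectionOn-fromRelation :
  ∀ {f : List Step → List Step} {P Q : List Step → Set}
  (R : List Step → List Step → Set) →
  (∀ p → P p → ∃ (R p)) →
  (∀ {p r} → R p r → f p ≡ r) →
  (∀ {p q r} → R p r → R q r → p ≡ q) →
  (∀ r → Q r → ∃ λ p → R p r) →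
  (∀ {p r} → R p r → P p ⇔ Q r) →
  BijectionOn f P Q
bijectionOn-fromRelation {Q = Q} R total computes unique onto transfer = record
  { maps       = λ p Pp → let (r , Rpr) = total p Pp in
                   subst Q (sym (computes Rpr)) (to (transfer Rpr) Pp)
  ; injective  = λ p q Pp Pq fp≡fq →
                   let (r , Rpr) = total p Pp ; (r′ , Rqr′) = total q Pq in
                   unique Rpr (subst (R q) (trans (sym (computes Rqr′))
                                          (trans (sym fp≡fq) (computes Rpr))) Rqr′)
  ; surjective = λ r Qr → let (p , Rpr) = onto r Qr in
                   p , from (transfer Rpr) Qr , computes Rpr
  }

module Blocks (n : ℕ) where

  -- Before j p r: p is read from x = 3j, just left of the designated column
  -- 3j+1, and r is what γ makes of it.  After i p r: p is read from x = 3i+2, just right of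
  -- the designated column 3i+1.
  data After : ℕ → List Step → List Step → Set
  data Before : ℕ → List Step → List Step → Set where
    cross-H  : ∀ {j p r} → After j p r → Before j (H ∷ p) r
    cross-UU : ∀ {j p r} → After j p r → Before j (U ∷ U ∷ p) (VU ∷ r)
    cross-DD : ∀ {j p r} → After j p r → Before j (D ∷ D ∷ p) (VD ∷ r)
  data After where
    done     : After n [] []
    step-U   : ∀ {i p r} → Before (suc i) p r → After i (U ∷ p) (U ∷ r)
    step-D   : ∀ {i p r} → Before (suc i) p r → After i (D ∷ p) (D ∷ r)
    cross-HH : ∀ {i p r} → Before (suc (suc i)) p r → After i (H ∷ H ∷ p) (H ∷ r)

  Before-index≤ : ∀ {j p r} → Before j p r → j ≤ n
  After-index≤  : ∀ {i p r} → After i p r → i ≤ n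
  Before-index≤ (cross-H g)  = After-index≤ g
  Before-index≤ (cross-UU g) = After-index≤ g
  Before-index≤ (cross-DD g) = After-index≤ g
  After-index≤ done         = ≤-refl
  After-index≤ (step-U g)   = <⇒≤ (Before-index≤ g)
  After-index≤ (step-D g)   = <⇒≤ (Before-index≤ g)
  After-index≤ (cross-HH g) = <⇒≤ (<⇒≤ (Before-index≤ g))

  d : ℕ → Bool
  d = designated n

  γ-Before : ∀ {j p r x} → Before j p r → x ≡ 3 * j → γFrom d x p ≡ r
  γ-After  : ∀ {i p r x} → After i p r → x ≡ 3 * i + 2 → γFrom d x p ≡ r
  γ-Before {j} (cross-H {p = p} g) refl =
    trans (γFrom-drop d (3 * j) p (designated-3i+1≡true (After-index≤ g) (+-comm 1 (3 * j))))
          (γ-After g refl)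
  γ-Before {j} (cross-UU {p = p} g) refl =
    trans (γPair-merge d (3 * j) U p (designated-3i+1≡true (After-index≤ g) refl))
          (cong (VU ∷_) (γ-After g (+-assoc _ 1 1)))
  γ-Before {j} (cross-DD {p = p} g) refl =
    trans (γPair-merge d (3 * j) D p (designated-3i+1≡true (After-index≤ g) refl))
          (cong (VD ∷_) (γ-After g (+-assoc _ 1 1)))
  γ-After done _ = refl
  γ-After {i} (step-U {p = p} g) refl =
    trans (γPair-keep d (3 * i + 2) U p (designated-3j≡false n (suc i) (3i+2+1≡3[1+i] i)))
          (cong (U ∷_) (γ-Before g (3i+2+1≡3[1+i] i)))
  γ-After {i} (step-D {p = p} g) refl =
    trans (γPair-keep d (3 * i + 2) D p (designated-3j≡false n (suc i) (3i+2+1≡3[1+i] i)))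
          (cong (D ∷_) (γ-Before g (3i+2+1≡3[1+i] i)))
  γ-After {i} (cross-HH {p = p} g) refl =
    trans (γFrom-keep d (3 * i + 2) (H ∷ p) (designated-3j≡false n (suc i) (1+[3i+2]≡3[1+i] i)))
    (trans (γPair-merge d (3 * i + 2) H p
              (designated-3i+1≡true (<⇒≤ (Before-index≤ g)) (3i+2+2≡3[1+i]+1 i)))
           (cong (H ∷_) (γ-Before g (3i+2+2+2≡3[2+i] i))))

  Before-injective : ∀ {j p q r} → Before j p r → Before j q r → p ≡ q
  After-injective  : ∀ {i p q r} → After i p r → After i q r → p ≡ q
  Before-injective (cross-H a)  (cross-H b)  = cong (H ∷_) (After-injective a b)
  Before-injective (cross-H ()) (cross-UU _)
  Before-injective (cross-H ()) (cross-DD _)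
  Before-injective (cross-UU _) (cross-H ())
  Before-injective (cross-DD _) (cross-H ())
  Before-injective (cross-UU a) (cross-UU b) = cong (λ p → U ∷ U ∷ p) (After-injective a b)
  Before-injective (cross-DD a) (cross-DD b) = cong (λ p → D ∷ D ∷ p) (After-injective a b)
  After-injective done         done         = refl
  After-injective (step-U a)   (step-U b)   = cong (U ∷_) (Before-injective a b)
  After-injective (step-D a)   (step-D b)   = cong (D ∷_) (Before-injective a b)
  After-injective (cross-HH a) (cross-HH b) = cong (λ p → H ∷ H ∷ p) (Before-injective a b)

  Before⇒InSC : ∀ {j p r} → Before j p r → All InSC p
  After⇒InSC  : ∀ {i p r} → After i p r → All InSC p
  Before⇒InSC (cross-H g)  = inH ∷ After⇒InSC g
  Before⇒InSC (cross-UU g) = inU ∷ inU ∷ After⇒InSC g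
  Before⇒InSC (cross-DD g) = inD ∷ inD ∷ After⇒InSC g
  After⇒InSC done         = []
  After⇒InSC (step-U g)   = inU ∷ Before⇒InSC g
  After⇒InSC (step-D g)   = inD ∷ Before⇒InSC g
  After⇒InSC (cross-HH g) = inH ∷ inH ∷ Before⇒InSC g

  Before⇒smooth : ∀ {j p r x} → Before j p r → x ≡ 3 * j →
                  ∀ i → j ≤ i → i ≤ n → SmoothFrom (3 * i + 1) x p
  After⇒smooth  : ∀ {i p r x} → After i p r → x ≡ 3 * i + 2 →
                  ∀ k → i < k → k ≤ n → SmoothFrom (3 * k + 1) x p
  Before⇒smooth {j} (cross-H g) refl i j≤i i≤n with m≤n⇒m<n∨m≡n j≤i
  ... | inj₁ j<i  = there (After⇒smooth g refl i j<i i≤n)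
  ... | inj₂ refl = midH (+-comm 1 (3 * j))
  Before⇒smooth (cross-UU g) refl i j≤i i≤n with m≤n⇒m<n∨m≡n j≤i
  ... | inj₁ j<i  = there (there (After⇒smooth g (+-assoc _ 1 1) i j<i i≤n))
  ... | inj₂ refl = pair refl
  Before⇒smooth (cross-DD g) refl i j≤i i≤n with m≤n⇒m<n∨m≡n j≤i
  ... | inj₁ j<i  = there (there (After⇒smooth g (+-assoc _ 1 1) i j<i i≤n))
  ... | inj₂ refl = pair refl
  After⇒smooth done _ k n<k k≤n = contradiction k≤n (<⇒≱ n<k)
  After⇒smooth {i} (step-U g) refl k i<k k≤n =
    there (Before⇒smooth g (3i+2+1≡3[1+i] i) k i<k k≤n)
  After⇒smooth {i} (step-D g) refl k i<k k≤n =
    there (Before⇒smooth g (3i+2+1≡3[1+i] i) k i<k k≤n)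
  After⇒smooth {i} (cross-HH g) refl k i<k k≤n with m≤n⇒m<n∨m≡n i<k
  ... | inj₁ 1+i<k = there (there (Before⇒smooth g (3i+2+2+2≡3[2+i] i) k 1+i<k k≤n))
  ... | inj₂ refl  = pair (3i+2+2≡3[1+i]+1 i)

  Before⇒NoVV : ∀ {j p r} → Before j p r → NoVV r
  After⇒NoVV  : ∀ {i p r} → After i p r → NonVerticalHead r × NoVV r
  Before⇒NoVV (cross-H g)  = proj₂ (After⇒NoVV g)
  Before⇒NoVV (cross-UU g) = let (h , nv) = After⇒NoVV g in NoVV-∷ h nv
  Before⇒NoVV (cross-DD g) = let (h , nv) = After⇒NoVV g in NoVV-∷ h nv
  After⇒NoVV done         = tt , tt
  After⇒NoVV (step-U g)   = refl , NoVV-∷-nonvertical refl (Before⇒NoVV g)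
  After⇒NoVV (step-D g)   = refl , NoVV-∷-nonvertical refl (Before⇒NoVV g)
  After⇒NoVV (cross-HH g) = refl , NoVV-∷-nonvertical refl (Before⇒NoVV g)

  Δx-Before : ∀ {j p r} → Before j p r → Δx p ≡ 3 * Δx r + 2
  Δx-After  : ∀ {i p r} → After i p r → Δx p ≡ 3 * Δx r
  Δx-Before (cross-H g)  = trans (cong (_+_ 2) (Δx-After g)) (+-comm 2 _)
  Δx-Before (cross-UU g) = trans (cong (_+_ 2) (Δx-After g)) (+-comm 2 _)
  Δx-Before (cross-DD g) = trans (cong (_+_ 2) (Δx-After g)) (+-comm 2 _)
  Δx-After done                 = refl
  Δx-After (step-U {r = r} g)   = trans (cong suc (Δx-Before g)) (1+[3i+2]≡3[1+i] (Δx r))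
  Δx-After (step-D {r = r} g)   = trans (cong suc (Δx-Before g)) (1+[3i+2]≡3[1+i] (Δx r))
  Δx-After (cross-HH {r = r} g) = trans (cong (_+_ 4) (Δx-Before g)) (4+[3i+2]≡3[2+i] (Δx r))

  Δy-Before : ∀ {j p r} → Before j p r → Δy p ≡ Δy r
  Δy-After  : ∀ {i p r} → After i p r → Δy p ≡ Δy r
  Δy-Before (cross-H g)  = trans (ℤ.+-identityˡ _) (Δy-After g)
  Δy-Before (cross-UU {p = p} g) =
    trans (sym (ℤ.+-assoc (+ 1) (+ 1) (Δy p))) (cong (+ 2 +ℤ_) (Δy-After g))
  Δy-Before (cross-DD {p = p} g) =
    trans (sym (ℤ.+-assoc -[1+ 0 ] -[1+ 0 ] (Δy p))) (cong (-[1+ 1 ] +ℤ_) (Δy-After g))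
  Δy-After done         = refl
  Δy-After (step-U g)   = cong (+ 1 +ℤ_) (Δy-Before g)
  Δy-After (step-D g)   = cong (-[1+ 0 ] +ℤ_) (Δy-Before g)
  Δy-After (cross-HH g) = cong (+ 0 +ℤ_) (trans (ℤ.+-identityˡ _) (Δy-Before g))

  Before⇒endpoint⇔ : ∀ {j p r N m} → Before j p r →
                     endpoint p ≡ (3 * N + 2 , m) ⇔ endpoint r ≡ (N , m)
  Before⇒endpoint⇔ {p = p} {r} g = mk⇔
    (λ ep → let (ex , ey) = to (endpoint≡⇔ p) ep in
      from (endpoint≡⇔ r) (3*+2-injective (trans (sym (Δx-Before g)) ex) ,
                                       trans (sym (Δy-Before g)) ey))
    (λ er → let (ex , ey) = to (endpoint≡⇔ r) er in
      from (endpoint≡⇔ p) (trans (Δx-Before g) (cong (λ a → 3 * a + 2) ex) ,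
                                       trans (Δy-Before g) ey))

  Before⇒above⇔ : ∀ {k j p r x x′ y y′} → Before j p r → y ≡ y′ →
                  AboveFrom k (x , y) p ⇔ AboveFrom k (x′ , y′) r
  After⇒above⇔  : ∀ {k i p r x x′ y y′} → After i p r → y ≡ y′ →
                  AboveFrom k (x , y) p ⇔ AboveFrom k (x′ , y′) r
  Before⇒above⇔ {r = r} (cross-H g) refl = mk⇔
    (λ { (_ ∷ hs) → to (After⇒above⇔ g (ℤ.+-identityʳ _)) hs })
    (λ hr → AboveFrom-head r hr ∷ from (After⇒above⇔ g (ℤ.+-identityʳ _)) hr)
  Before⇒above⇔ {y = y} (cross-UU g) refl = mk⇔
    (λ { (h ∷ _ ∷ hs) → h ∷ to (After⇒above⇔ g (ℤ.+-assoc y (+ 1) (+ 1))) hs })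
    (λ { (h ∷ hr) → h ∷ ℤ.≤-trans h (ℤ.i≤i+j y (+ 1))
                      ∷ from (After⇒above⇔ g (ℤ.+-assoc y (+ 1) (+ 1))) hr })
  Before⇒above⇔ {y = y} (cross-DD {p = p} g) refl = mk⇔
    (λ { (h ∷ _ ∷ hs) → h ∷ to (After⇒above⇔ g (ℤ.+-assoc y -[1+ 0 ] -[1+ 0 ])) hs })
    (λ { (h ∷ hr) → let hs = from (After⇒above⇔ g (ℤ.+-assoc y -[1+ 0 ] -[1+ 0 ])) hr in
                    h ∷ ℤ.≤-trans (AboveFrom-head p hs) (ℤ.i-j≤i (y +ℤ -[1+ 0 ]) (+ 1)) ∷ hs })
  After⇒above⇔ done refl = mk⇔ (λ { (h ∷ []) → h ∷ [] }) (λ { (h ∷ []) → h ∷ [] })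
  After⇒above⇔ (step-U g) refl = mk⇔
    (λ { (h ∷ hs) → h ∷ to (Before⇒above⇔ g refl) hs })
    (λ { (h ∷ hr) → h ∷ from (Before⇒above⇔ g refl) hr })
  After⇒above⇔ (step-D g) refl = mk⇔
    (λ { (h ∷ hs) → h ∷ to (Before⇒above⇔ g refl) hs })
    (λ { (h ∷ hr) → h ∷ from (Before⇒above⇔ g refl) hr })
  After⇒above⇔ (cross-HH {r = r} g) refl = mk⇔
    (λ { (h ∷ _ ∷ hs) → h ∷ to (Before⇒above⇔ g (ℤ.+-identityʳ _)) hs })
    (λ { (h ∷ hr) → h ∷ AboveFrom-head r hr
                      ∷ from (Before⇒above⇔ g (ℤ.+-identityʳ _)) hr })

  parse-Before : ∀ j {x} p → x ≡ 3 * j → All InSC p → EndsAt (3 * n + 2) x p →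
                 SmoothAfter n x p → ∃ (Before j p)
  parse-After  : ∀ i {x} p → x ≡ 3 * i + 2 → All InSC p → EndsAt (3 * n + 2) x p →
                 SmoothAfter n x p → ∃ (After i p)
  parse-Before j p refl ins w sm
    with sm j (3*-≤-cancel (EndsAt⇒≤ (3 * j) p w)) (m<m+n (3 * j) z<s)
  parse-Before j (H ∷ p) refl (_ ∷ ins) w sm | midH _ =
    map₂ cross-H (parse-After j p refl ins w (SmoothAfter-tail sm))
  parse-Before j (U ∷ U ∷ p) refl (_ ∷ _ ∷ ins) w sm | pair _ =
    map (VU ∷_) cross-UU (parse-After j p (+-assoc _ 1 1) ins
      w (SmoothAfter-tail (SmoothAfter-tail sm)))
  parse-Before j (D ∷ D ∷ p) refl (_ ∷ _ ∷ ins) w sm | pair _ =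
    map (VD ∷_) cross-DD (parse-After j p (+-assoc _ 1 1) ins
      w (SmoothAfter-tail (SmoothAfter-tail sm)))
  parse-Before j (H ∷ H ∷ p) refl ins w sm | pair e =
    contradiction (+-cancelˡ-≡ (3 * j) 2 1 e) λ ()
  parse-Before j (VU ∷ VU ∷ p) refl (() ∷ _) w sm | pair _
  parse-Before j (VD ∷ VD ∷ p) refl (() ∷ _) w sm | pair _
  parse-Before j (s ∷ p) refl (s∈ ∷ ins) w sm | there S =
    contradiction (+-monoʳ-≤ (3 * j) (dx-pos s∈)) (<⇒≱ (SmoothFrom-< ins S))
  parse-After i [] refl _ w _ with 3*+2-injective {i} {n} w
  ... | refl = [] , done
  parse-After i (U ∷ p) refl (_ ∷ ins) w sm =
    map (U ∷_) step-U (parse-Before (suc i) p (3i+2+1≡3[1+i] i) ins w (SmoothAfter-tail sm))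
  parse-After i (D ∷ p) refl (_ ∷ ins) w sm =
    map (D ∷_) step-D (parse-Before (suc i) p (3i+2+1≡3[1+i] i) ins w (SmoothAfter-tail sm))
  parse-After i (H ∷ p) refl ins w sm with sm (suc i) 1+i≤n 3i+2<3[1+i]+1
    where
    1+i≤n : suc i ≤ n
    1+i≤n = 3*-≤-cancel (≤-trans (m≤m+n (3 * suc i) 1)
              (subst (_≤ 3 * n + 2) (3i+2+2≡3[1+i]+1 i) (EndsAt⇒≤ (3 * i + 2 + 2) p w)))
    3i+2<3[1+i]+1 : 3 * i + 2 < 3 * suc i + 1
    3i+2<3[1+i]+1 = subst (3 * i + 2 <_) (3i+2+2≡3[1+i]+1 i) (m<m+n (3 * i + 2) z<s)
  ... | midH e = contradiction (trans (sym (1+[3i+2]≡3[1+i] i)) e) (m+1+n≢m (3 * suc i) ∘ sym)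
  parse-After i (H ∷ H ∷ p) refl (_ ∷ _ ∷ ins) w sm | pair _ =
    map (H ∷_) cross-HH (parse-Before (suc (suc i)) p (3i+2+2+2≡3[2+i] i) ins
      w (SmoothAfter-tail (SmoothAfter-tail sm)))
  parse-After i (H ∷ p) refl (_ ∷ ins) w sm | there S =
    contradiction (SmoothFrom-< ins S) (<-irrefl (3i+2+2≡3[1+i]+1 i))
  parse-After i (VU ∷ p) refl (() ∷ _) w sm
  parse-After i (VD ∷ p) refl (() ∷ _) w sm

  build-Before : ∀ j r → NoVV r → j + Δx r ≡ n → ∃ λ p → Before j p r
  build-After  : ∀ i r → NonVerticalHead r → NoVV r → i + Δx r ≡ n → ∃ λ p → After i p r
  build-Before j (VU ∷ r) nv e =
    map (λ p → U ∷ U ∷ p) cross-UU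
      (build-After j r (NoVV-vertical⇒NonVerticalHead refl nv) (NoVV-tail nv) e)
  build-Before j (VD ∷ r) nv e =
    map (λ p → D ∷ D ∷ p) cross-DD
      (build-After j r (NoVV-vertical⇒NonVerticalHead refl nv) (NoVV-tail nv) e)
  build-Before j []      nv e = map (H ∷_) cross-H (build-After j [] tt nv e)
  build-Before j (U ∷ r) nv e = map (H ∷_) cross-H (build-After j (U ∷ r) refl nv e)
  build-Before j (D ∷ r) nv e = map (H ∷_) cross-H (build-After j (D ∷ r) refl nv e)
  build-Before j (H ∷ r) nv e = map (H ∷_) cross-H (build-After j (H ∷ r) refl nv e)
  build-After i [] _ _ e with trans (sym (+-identityʳ i)) e
  ... | refl = [] , done
  build-After i (U ∷ r) _ nv e =
    map (U ∷_) step-U (build-Before (suc i) r (NoVV-tail nv) (trans (sym (+-suc i (Δx r))) e))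
  build-After i (D ∷ r) _ nv e =
    map (D ∷_) step-D (build-Before (suc i) r (NoVV-tail nv) (trans (sym (+-suc i (Δx r))) e))
  build-After i (H ∷ r) _ nv e =
    map (λ p → H ∷ H ∷ p) cross-HH
      (build-Before (suc (suc i)) r (NoVV-tail nv) (trans (sym (+-suc-suc i (Δx r))) e))
    where
    +-suc-suc : ∀ a b → a + suc (suc b) ≡ suc (suc (a + b))
    +-suc-suc a b = trans (+-suc a (suc b)) (cong suc (+-suc a b))

  Delannoy⇒Before : ∀ {p m} → DelannoyTo (3 * n + 2 , m) p → SmoothAll n p → ∃ (Before 0 p)
  Delannoy⇒Before {p} (ins , ep) sm =
    parse-Before 0 p refl ins (endFrom⇒EndsAt 0 (+ 0) p (cong proj₁ ep)) (λ i i≤n _ → sm i i≤n)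

  VC⇒Before : ∀ {r m} → VCTo (n , m) r → ∃ λ p → Before 0 p r
  VC⇒Before {r} (nv , er) = build-Before 0 r nv (proj₁ (to (endpoint≡⇔ r) er))

  Before⇒Delannoy⇔VC : ∀ {p r m} → Before 0 p r →
                       (DelannoyTo (3 * n + 2 , m) p × SmoothAll n p) ⇔ VCTo (n , m) r
  Before⇒Delannoy⇔VC g = mk⇔
    (λ ((_ , ep) , _) → Before⇒NoVV g , to (Before⇒endpoint⇔ g) ep)
    (λ (_ , er) → (Before⇒InSC g , from (Before⇒endpoint⇔ g) er) ,
                  λ i i≤n → Before⇒smooth g refl i z≤n i≤n)

  Before⇒Schröder⇔VC : ∀ {p r m} → Before 0 p r →
                       (SchroderTo (3 * n + 2 , m) p × SmoothAll n p) ⇔ (VCTo (n , m) r × Nonneg r)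
  Before⇒Schröder⇔VC g = mk⇔
    (λ ((dp , nn) , sm) → to (Before⇒Delannoy⇔VC g) (dp , sm) , to (Before⇒above⇔ g refl) nn)
    (λ (vc , nn) → let (dp , sm) = from (Before⇒Delannoy⇔VC g) vc in
                   (dp , from (Before⇒above⇔ g refl) nn) , sm)

theorem21 : (n : ℕ) (m : ℤ) →
    BijectionOn (γ n)
      (λ p → SchroderTo (3 * n + 2 , m) p × SmoothAll n p)
      (λ r → VCTo (n , m) r × Nonneg r)
    × BijectionOn (γ n)
      (λ p → DelannoyTo (3 * n + 2 , m) p × SmoothAll n p)
      (λ r → VCTo (n , m) r)
theorem21 n m =
    bijectionOn-fromRelation (Before 0) (λ _ ((dp , _) , sm) → Delannoy⇒Before dp sm)
      (λ g → γ-Before g refl) Before-injective (λ _ (vc , _) → VC⇒Before vc) Before⇒Schröder⇔VC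
  , bijectionOn-fromRelation (Before 0) (λ _ (dp , sm) → Delannoy⇒Before dp sm)
      (λ g → γ-Before g refl) Before-injective (λ _ → VC⇒Before) Before⇒Delannoy⇔VC
  where open Blocks n
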